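{- Let $p$ be a prime, $n\ge1$, $F=\mathbb{F}_{p^n}$, $i$ a positive integer with $\gcd(i,n)=1$, and $f(x)=x^{p^i+p-1}$. Define $\mu_a(x)=a^{2-p}x$ for $a\in F^\times$ and $\nu(a)=a$ for $a\in F$. Then $\tilde B_{f,\mu,\nu}(x,a)$ is $\mathbb{F}_p$-bilinear in $(x,a)$.
   Context: For $m\ge1$, $[f]^m(x_1,\dots,x_m)=\sum_{I\subseteq\{1,\dots,m\}}(-1)^{m-|I|}f\big(\sum_{k\in I}x_k\big)$. $\tilde B_f(x,y)=[f]^p(x,y,\dots,y)$ ($y$ repeated $p-1$ times). For a map $a\mapsto\mu_a$ from $F^\times$ to $\mathbb{F}_p$-linear automorphisms of $F$ and a permutation $\nu$ of $F$ fixing $0$, $\tilde B_{f,\mu,\nu}(x,a)=\mu_a(\tilde B_f(x,\nu(a)))$ for $a\neq0$ and $\tilde B_{f,\mu,\nu}(x,0)=0$. -}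

module Defs where

open import Level using (Level; _⊔_)
open import Data.Nat as ℕ using (ℕ; zero; suc; _∸_)
open import Data.Fin using (Fin; zero; suc)
open import Data.Fin.Subset using (Subset; Side; inside; outside; ∣_∣)
open import Data.Vec using (Vec; []; _∷_)
open import Data.List using (List; []; _∷_; _++_; map)
open import Data.Product using (Σ; _×_; _,_)
open import Relation.Nullary using (¬_; yes; no)
open import Relation.Binary using (Decidable)
open import Algebra.Bundles using (CommutativeRing)

-- A field: a commutative ring with 1 ≠ 0, decidable equality and
-- inverses of nonzero elements (_⁻¹ is total; its value at 0 is irrelevant).
record Field (c ℓ : Level) : Set (Level.suc (c ⊔ ℓ)) where
  field
    commutativeRing : CommutativeRing c ℓ
  open CommutativeRing commutativeRing public
  field
    1≉0     : ¬ (1# ≈ 0#)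
    _≟_     : Decidable _≈_
    _⁻¹     : Carrier → Carrier
    inverse : ∀ a → ¬ (a ≈ 0#) → (a * (a ⁻¹)) ≈ 1#

module FieldOps {c ℓ} (F : Field c ℓ) where
  open Field F public using (Carrier; _≈_; _+_; _*_; -_; 0#; 1#; _⁻¹; _≟_)

  _^_ : Carrier → ℕ → Carrier
  x ^ zero  = 1#
  x ^ suc n = x * (x ^ n)

  -- k-fold sum k · x  (the F_p-scalar action, k ∈ ℕ)
  _·_ : ℕ → Carrier → Carrier
  zero  · x = 0#
  suc k · x = x + (k · x)

  ∑ : (m : ℕ) → (Fin m → Carrier) → Carrier
  ∑ zero    g = 0#
  ∑ (suc m) g = g zero + ∑ m (λ k → g (suc k))

  sumL : List Carrier → Carrier
  sumL []       = 0#
  sumL (x ∷ xs) = x + sumL xs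

  allSubsets : (m : ℕ) → List (Subset m)
  allSubsets zero    = [] ∷ []
  allSubsets (suc m) = map (inside ∷_) (allSubsets m) ++ map (outside ∷_) (allSubsets m)

  sumOver : {m : ℕ} → Subset m → (Fin m → Carrier) → Carrier
  sumOver []            x = 0#
  sumOver (inside ∷ I)  x = x zero + sumOver I (λ k → x (suc k))
  sumOver (outside ∷ I) x = sumOver I (λ k → x (suc k))

  bracket : (f : Carrier → Carrier) (m : ℕ) → (Fin m → Carrier) → Carrier
  bracket f m x = sumL (map (λ I → ((- 1#) ^ (m ∸ ∣ I ∣)) * f (sumOver I x)) (allSubsets m))

  Btilde : (p : ℕ) (f : Carrier → Carrier) → Carrier → Carrier → Carrier
  Btilde p f x y = bracket f p (λ { zero → x ; (suc _) → y })

  BtildeMuNu : (p : ℕ) (f : Carrier → Carrier)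
               (μ : (a : Carrier) → ¬ (a ≈ 0#) → Carrier → Carrier)
               (ν : Carrier → Carrier) → Carrier → Carrier → Carrier
  BtildeMuNu p f μ ν x a with a ≟ 0#
  ... | yes _  = 0#
  ... | no a≢0 = μ a a≢0 (Btilde p f x (ν a))

  IsFpBilinear : (Carrier → Carrier → Carrier) → Set (c ⊔ ℓ)
  IsFpBilinear B =
    (∀ x x′ a → B (x + x′) a ≈ (B x a + B x′ a)) ×
    (∀ x a a′ → B x (a + a′) ≈ (B x a + B x a′)) ×
    (∀ (k : ℕ) x a → B (k · x) a ≈ (k · B x a)) ×
    (∀ (k : ℕ) x a → B x (k · a) ≈ (k · B x a))

  HasCard : ℕ → Set (c ⊔ ℓ)
  HasCard N = Σ (Fin N → Carrier) λ e →
    (∀ i j → e i ≈ e j → i ≡ j) × (∀ y → Σ (Fin N) λ i → e i ≈ y)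
    where open import Relation.Binary.PropositionalEquality using (_≡_)

module Submission where

-- The bracket [g]^m(x_1,…,x_m) is an iterated finite difference:
-- [g]^(m+1)(x_0,…) = [Δ_{x_0} g]^m(…) with Δ_c g(t) = g(c+t) - g(t).  Each Δ_y
-- lowers the degree of a polynomial function by one and multiplies its leading
-- coefficient by (degree)·y, so for g of degree m with leading coefficient a,
-- [g]^m(y,…,y) = m!·a·y^m ("bracket-lead").  An additive map A (here the Frobenius
-- power t ↦ t^q) behaves like a linear function under differences, which gives
-- [A·h]^(m+1)(y,…,y) = (m+1)!·A(y)·a·y^m ("bracket-leibniz").  Writing
-- Δ_x f(t) = x^q (x+t)^(p-1) + t^q ((x+t)^(p-1) - t^(p-1)) these two facts give
--   B̃_f(x,y) = (p-1)! (x^q y^(p-1) + (p-1) x y^q y^(p-2)),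
-- hence B̃_{f,μ,ν}(x,a) = (p-1)! (x^q a + (p-1) x a^q), which is bilinear because
-- x ↦ x^q is additive (Frobenius).

open import Defs
open import Level using (Level; _⊔_)
open import Data.Empty using (⊥-elim)
open import Data.Sum using (inj₁; inj₂)
open import Data.Product using (Σ; _×_; _,_; proj₁; proj₂)
open import Data.Maybe using (Maybe; just; nothing)
open import Data.Nat as ℕ using (ℕ; zero; suc; _∸_; _!; _<_; _≤_; _≥_; s≤s; z≤n)
import Data.Nat
import Data.Nat.Properties as ℕP
open import Data.Nat.GCD using (gcd)
open import Data.Nat.Primality using (Prime; euclidsLemma; prime⇒nonTrivial)
open import Data.Nat.Divisibility using (_∣_; divides; ∣⇒≤; ∣1⇒≡1; m∣m*n)
open import Data.Nat.DivMod using (m/n*n≡m)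
open import Data.Nat.Combinatorics using (_C_; k![n∸k]!∣n!; nCn≡1)
open import Data.Nat.Combinatorics.Specification using (nCk≡n!/k![n-k]!)
open import Data.Integer as ℤ using (ℤ; +_; -[1+_]; +[1+_])
import Data.Integer.Properties as ℤP
open import Data.Sign as Sign using (Sign)
open import Data.Fin as Fin using (Fin; toℕ; fromℕ)
import Data.Fin.Properties as FinP
open import Data.Fin.Subset using (Subset; inside; outside; ∣_∣)
open import Data.Fin.Subset.Properties using (∣p∣≤n)
import Data.Vec as Vec
open import Data.List using (List; []; _∷_; _++_; map)
import Data.List.Properties as ListP
open import Relation.Nullary using (¬_; yes; no; contradiction)
open import Relation.Binary.PropositionalEquality as ≡ using (_≡_)
open import Algebra.Bundles using (CommutativeRing)
open import Algebra.Solver.Ring.AlmostCommutativeRing using (fromCommutativeRing; _-Raw-AlmostCommutative⟶_)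
import Algebra.Solver.Ring as RingSolver

-- A prime p does not divide j! for j < p (Euclid's lemma applied to each factor).
prime∤factorial : ∀ {p} → Prime p → ∀ j → j < p → ¬ (p ∣ j !)
prime∤factorial pr zero 0<p p∣1 =
  ℕP.<⇒≢ (ℕ.nonTrivial⇒n>1 _ {{prime⇒nonTrivial pr}}) (≡.sym (∣1⇒≡1 p∣1))
prime∤factorial pr (suc j) j<p p∣j! with euclidsLemma (suc j) (j !) pr p∣j!
... | inj₁ p∣1+j = ℕP.<⇒≱ j<p (∣⇒≤ p∣1+j)
... | inj₂ p∣j!′ = prime∤factorial pr j (ℕP.<-trans (ℕP.n<1+n j) j<p) p∣j!′

-- p divides (p C k)·k!·(p-k)!, which equals p!.
divides-binomial*factorials : ∀ m k → k ≤ suc m → suc m ∣ (suc m C k) ℕ.* (k ! ℕ.* (suc m ∸ k) !)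
divides-binomial*factorials m k k≤p = ≡.subst (suc m ∣_) (≡.sym product≡p!) (m∣m*n (m !))
  where
  product≡p! : (suc m C k) ℕ.* (k ! ℕ.* (suc m ∸ k) !) ≡ suc m !
  product≡p! = ≡.trans (≡.cong (ℕ._* (k ! ℕ.* (suc m ∸ k) !)) (nCk≡n!/k![n-k]! k≤p))
                       (m/n*n≡m {{ℕP._!*_!≢0 k (suc m ∸ k)}} (k![n∸k]!∣n! k≤p))

-- p divides the middle binomial coefficients p C k (0 < k < p): it divides
-- (p C k)·k!·(p-k)! but neither k! nor (p-k)!.
prime∣binomial : ∀ {p k} → Prime p → 0 < k → k < p → p ∣ p C k
prime∣binomial {suc m} {k} pr 0<k k<p
  with euclidsLemma (suc m C k) _ pr (divides-binomial*factorials m k (ℕP.<⇒≤ k<p))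
... | inj₁ p∣C = p∣C
... | inj₂ p∣factorials with euclidsLemma (k !) ((suc m ∸ k) !) pr p∣factorials
...   | inj₁ p∣k!     = ⊥-elim (prime∤factorial pr k k<p p∣k!)
...   | inj₂ p∣[p∸k]! =
  ⊥-elim (prime∤factorial pr (suc m ∸ k) (ℕP.∸-monoʳ-< 0<k (ℕP.<⇒≤ k<p)) p∣[p∸k]!)

-- Every commutative ring R receives a ring morphism ℤ → R, so the standard ring
-- solver, with integer coefficients, proves polynomial identities in R.
module IntegerCoefficients {c ℓ} (R : CommutativeRing c ℓ) where
  open CommutativeRing R
  open import Algebra.Properties.Ring ring using (-1*x≈-x)
  open import Algebra.Properties.Group +-group using (ε⁻¹≈ε; ⁻¹-involutive)
  open import Algebra.Properties.AbelianGroup +-abelianGroup using (⁻¹-∙-comm)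
  open import Relation.Binary.Reasoning.Setoid setoid

  -- ι n = 1 + ⋯ + 1; the clauses make ι 0 and ι 1 literally 0# and 1#, so that the
  -- solver's constants 0 and 1 denote 0# and 1#.
  ι : ℕ → Carrier
  ι zero          = 0#
  ι (suc zero)    = 1#
  ι (suc (suc n)) = 1# + ι (suc n)

  ι-suc : ∀ n → ι (suc n) ≈ 1# + ι n
  ι-suc zero    = sym (+-identityʳ _)
  ι-suc (suc n) = refl

  ι-+ : ∀ m n → ι (m ℕ.+ n) ≈ ι m + ι n
  ι-+ zero    n = sym (+-identityˡ _)
  ι-+ (suc m) n = begin
    ι (suc (m ℕ.+ n))  ≈⟨ ι-suc (m ℕ.+ n) ⟩
    1# + ι (m ℕ.+ n)   ≈⟨ +-congˡ (ι-+ m n) ⟩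
    1# + (ι m + ι n)   ≈⟨ +-assoc _ _ _ ⟨
    (1# + ι m) + ι n   ≈⟨ +-congʳ (ι-suc m) ⟨
    ι (suc m) + ι n    ∎

  ι-* : ∀ m n → ι (m ℕ.* n) ≈ ι m * ι n
  ι-* zero    n = sym (zeroˡ _)
  ι-* (suc m) n = begin
    ι (n ℕ.+ m ℕ.* n)     ≈⟨ ι-+ n (m ℕ.* n) ⟩
    ι n + ι (m ℕ.* n)     ≈⟨ +-cong (sym (*-identityˡ _)) (ι-* m n) ⟩
    1# * ι n + ι m * ι n  ≈⟨ distribʳ _ _ _ ⟨
    (1# + ι m) * ι n      ≈⟨ *-congʳ (ι-suc m) ⟨
    ι (suc m) * ι n       ∎

  ⟦_⟧ : ℤ → Carrier
  ⟦ + n ⟧      = ι n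
  ⟦ -[1+ n ] ⟧ = - ι (suc n)

  ⊖-hom : ∀ m n → ⟦ m ℤ.⊖ n ⟧ ≈ ι m - ι n
  ⊖-hom zero    zero    = sym (trans (+-congˡ ε⁻¹≈ε) (+-identityʳ _))
  ⊖-hom (suc m) zero    = sym (trans (+-congˡ ε⁻¹≈ε) (+-identityʳ _))
  ⊖-hom zero    (suc n) = sym (+-identityˡ _)
  ⊖-hom (suc m) (suc n) rewrite ℤP.[1+m]⊖[1+n]≡m⊖n m n = begin
    ⟦ m ℤ.⊖ n ⟧                     ≈⟨ ⊖-hom m n ⟩
    ι m - ι n                        ≈⟨ cancel-front 1# (ι m) (ι n) ⟨
    (1# + ι m) - (1# + ι n)          ≈⟨ +-cong (ι-suc m) (-‿cong (ι-suc n)) ⟨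
    ι (suc m) - ι (suc n)            ∎
    where
    cancel-front : ∀ a b c → (a + b) - (a + c) ≈ b - c
    cancel-front a b c = begin
      (a + b) + - (a + c)      ≈⟨ +-congˡ (⁻¹-∙-comm a c) ⟨
      (a + b) + (- a + - c)    ≈⟨ +-congʳ (+-comm a b) ⟩
      (b + a) + (- a + - c)    ≈⟨ +-assoc _ _ _ ⟩
      b + (a + (- a + - c))    ≈⟨ +-congˡ (+-assoc _ _ _) ⟨
      b + ((a + - a) + - c)    ≈⟨ +-congˡ (+-congʳ (-‿inverseʳ a)) ⟩
      b + (0# + - c)           ≈⟨ +-congˡ (+-identityˡ _) ⟩
      b - c                    ∎

  +-hom : ∀ i j → ⟦ i ℤ.+ j ⟧ ≈ ⟦ i ⟧ + ⟦ j ⟧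
  +-hom (+ m)    (+ n)    = ι-+ m n
  +-hom (+ m)    -[1+ n ] = ⊖-hom m (suc n)
  +-hom -[1+ m ] (+ n)    = trans (⊖-hom n (suc m)) (+-comm _ _)
  +-hom -[1+ m ] -[1+ n ] = begin
    - ι (suc (suc (m ℕ.+ n)))    ≈⟨ -‿cong (reflexive (≡.cong ι (ℕP.+-suc (suc m) n))) ⟨
    - ι (suc m ℕ.+ suc n)        ≈⟨ -‿cong (ι-+ (suc m) (suc n)) ⟩
    - (ι (suc m) + ι (suc n))    ≈⟨ ⁻¹-∙-comm _ _ ⟨
    - ι (suc m) + - ι (suc n)    ∎

  neg-hom : ∀ i → ⟦ ℤ.- i ⟧ ≈ - ⟦ i ⟧
  neg-hom (+ zero)  = sym ε⁻¹≈ε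
  neg-hom +[1+ n ]  = refl
  neg-hom -[1+ n ]  = sym (⁻¹-involutive _)

  -- ℤ multiplies sign and absolute value separately; ⟦_⟧ respects both.
  ⟦_⟧ₛ : Sign → Carrier
  ⟦ Sign.+ ⟧ₛ = 1#
  ⟦ Sign.- ⟧ₛ = - 1#

  sign-hom : ∀ s t → ⟦ s Sign.* t ⟧ₛ ≈ ⟦ s ⟧ₛ * ⟦ t ⟧ₛ
  sign-hom Sign.+ _      = sym (*-identityˡ _)
  sign-hom Sign.- Sign.+ = sym (*-identityʳ _)
  sign-hom Sign.- Sign.- = sym (trans (-1*x≈-x _) (⁻¹-involutive _))

  ◃-hom : ∀ s n → ⟦ s ℤ.◃ n ⟧ ≈ ⟦ s ⟧ₛ * ι n
  ◃-hom s      zero    = sym (zeroʳ _)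
  ◃-hom Sign.+ (suc n) = sym (*-identityˡ _)
  ◃-hom Sign.- (suc n) = sym (-1*x≈-x _)

  sign-abs : ∀ i → ⟦ i ⟧ ≈ ⟦ ℤ.sign i ⟧ₛ * ι ℤ.∣ i ∣
  sign-abs (+ n)     = sym (*-identityˡ _)
  sign-abs -[1+ n ]  = sym (-1*x≈-x _)

  *-hom : ∀ i j → ⟦ i ℤ.* j ⟧ ≈ ⟦ i ⟧ * ⟦ j ⟧
  *-hom i j = begin
    ⟦ i ℤ.* j ⟧
      ≈⟨ ◃-hom (ℤ.sign i Sign.* ℤ.sign j) (ℤ.∣ i ∣ ℕ.* ℤ.∣ j ∣) ⟩
    ⟦ ℤ.sign i Sign.* ℤ.sign j ⟧ₛ * ι (ℤ.∣ i ∣ ℕ.* ℤ.∣ j ∣)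
      ≈⟨ *-cong (sign-hom (ℤ.sign i) (ℤ.sign j)) (ι-* ℤ.∣ i ∣ ℤ.∣ j ∣) ⟩
    (⟦ ℤ.sign i ⟧ₛ * ⟦ ℤ.sign j ⟧ₛ) * (ι ℤ.∣ i ∣ * ι ℤ.∣ j ∣)
      ≈⟨ interchange _ _ _ _ ⟩
    (⟦ ℤ.sign i ⟧ₛ * ι ℤ.∣ i ∣) * (⟦ ℤ.sign j ⟧ₛ * ι ℤ.∣ j ∣)
      ≈⟨ *-cong (sign-abs i) (sign-abs j) ⟨
    ⟦ i ⟧ * ⟦ j ⟧ ∎
    where
    interchange : ∀ a b c d → (a * b) * (c * d) ≈ (a * c) * (b * d)
    interchange a b c d = begin
      (a * b) * (c * d)  ≈⟨ *-assoc a b (c * d) ⟩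
      a * (b * (c * d))  ≈⟨ *-congˡ (*-assoc b c d) ⟨
      a * ((b * c) * d)  ≈⟨ *-congˡ (*-congʳ (*-comm b c)) ⟩
      a * ((c * b) * d)  ≈⟨ *-congˡ (*-assoc c b d) ⟩
      a * (c * (b * d))  ≈⟨ *-assoc a c (b * d) ⟨
      (a * c) * (b * d)  ∎

  ℤ⟶R : ℤ.+-*-rawRing -Raw-AlmostCommutative⟶ fromCommutativeRing R
  ℤ⟶R = record
    { ⟦_⟧ = ⟦_⟧ ; +-homo = +-hom ; *-homo = *-hom ; -‿homo = neg-hom
    ; 0-homo = refl ; 1-homo = refl }

  coefficients-equal? : ∀ i j → Maybe (⟦ i ⟧ ≈ ⟦ j ⟧)
  coefficients-equal? i j with i ℤP.≟ j
  ... | yes i≡j = just (reflexive (≡.cong ⟦_⟧ i≡j))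
  ... | no _    = nothing

  open RingSolver ℤ.+-*-rawRing (fromCommutativeRing R) ℤ⟶R coefficients-equal? public
    using (solve; _:=_; _:+_; _:*_; _:-_; :-_; con; Polynomial)

  :0 :1 : ∀ {n} → Polynomial n
  :0 = con (+ 0)
  :1 = con (+ 1)

module FieldFacts {c ℓ} (F : Field c ℓ) where
  open Field F hiding (_≟_; zero)
  open FieldOps F using (_^_; _·_; sumL; allSubsets; sumOver; bracket; Btilde; BtildeMuNu; IsFpBilinear)
  open IntegerCoefficients commutativeRing
  open import Algebra.Properties.Ring ring using (-1*x≈-x; -‿distribˡ-*; x+x≈x⇒x≈0)
  open import Relation.Binary.Reasoning.Setoid setoid

  ^-cong : ∀ n {a b} → a ≈ b → a ^ n ≈ b ^ n
  ^-cong zero    a≈b = refl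
  ^-cong (suc n) a≈b = *-cong a≈b (^-cong n a≈b)

  ^-+ : ∀ m n u → u ^ (m ℕ.+ n) ≈ u ^ m * u ^ n
  ^-+ zero    n u = sym (*-identityˡ _)
  ^-+ (suc m) n u = trans (*-congˡ (^-+ m n u)) (sym (*-assoc _ _ _))

  1^n : ∀ n → 1# ^ n ≈ 1#
  1^n zero    = refl
  1^n (suc n) = trans (*-identityˡ _) (1^n n)

  ^-distrib-* : ∀ n a b → (a * b) ^ n ≈ a ^ n * b ^ n
  ^-distrib-* zero    a b = sym (*-identityˡ _)
  ^-distrib-* (suc n) a b = trans (*-congˡ (^-distrib-* n a b)) (interchange _ _ _ _)
    where
    interchange : ∀ a b A B → (a * b) * (A * B) ≈ (a * A) * (b * B)
    interchange = solve 4 (λ a b A B → (a :* b) :* (A :* B) := (a :* A) :* (b :* B)) refl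

  ^-* : ∀ m n u → u ^ (m ℕ.* n) ≈ (u ^ m) ^ n
  ^-* zero    n u = sym (1^n n)
  ^-* (suc m) n u =
    trans (^-+ n (m ℕ.* n) u) (trans (*-congˡ (^-* m n u)) (sym (^-distrib-* n u (u ^ m))))

  ·≈ι* : ∀ k u → k · u ≈ ι k * u
  ·≈ι* zero    u = sym (zeroˡ u)
  ·≈ι* (suc k) u = trans (+-congˡ (·≈ι* k u)) (trans (collect u (ι k)) (*-congʳ (sym (ι-suc k))))
    where
    collect : ∀ u I → u + I * u ≈ (1# + I) * u
    collect = solve 2 (λ u I → u :+ I :* u := (:1 :+ I) :* u) refl

  IsAdditive : (Carrier → Carrier) → Set (c ⊔ ℓ)
  IsAdditive φ = (∀ {u v} → u ≈ v → φ u ≈ φ v) × (∀ u v → φ (u + v) ≈ φ u + φ v)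

  additive-0 : ∀ {φ} → IsAdditive φ → φ 0# ≈ 0#
  additive-0 {φ} (φ-cong , φ-+) =
    x+x≈x⇒x≈0 (φ 0#) (trans (sym (φ-+ 0# 0#)) (φ-cong (+-identityˡ 0#)))

  additive-· : ∀ {φ} → IsAdditive φ → ∀ k u → φ (k · u) ≈ k · φ u
  additive-· φ-add         zero    u = additive-0 φ-add
  additive-· φ-add@(_ , φ-+) (suc k) u = trans (φ-+ u (k · u)) (+-congˡ (additive-· φ-add k u))

  bilinear-resp : ∀ {B B′ : Carrier → Carrier → Carrier} →
    (∀ x a → B x a ≈ B′ x a) → IsFpBilinear B′ → IsFpBilinear B
  bilinear-resp B≈B′ (add-x , add-a , scale-x , scale-a) =
      (λ x x′ a → trans (B≈B′ _ _) (trans (add-x x x′ a) (sym (+-cong (B≈B′ x a) (B≈B′ x′ a)))))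
    , (λ x a a′ → trans (B≈B′ _ _) (trans (add-a x a a′) (sym (+-cong (B≈B′ x a) (B≈B′ x a′)))))
    , (λ k x a → trans (B≈B′ _ _) (trans (scale-x k x a) (sym (·-cong k (B≈B′ x a)))))
    , (λ k x a → trans (B≈B′ _ _) (trans (scale-a k x a) (sym (·-cong k (B≈B′ x a)))))
    where
    ·-cong : ∀ k {u v} → u ≈ v → k · u ≈ k · v
    ·-cong zero    u≈v = refl
    ·-cong (suc k) u≈v = +-cong u≈v (·-cong k u≈v)

  twisted-form : (Carrier → Carrier) → Carrier → Carrier → Carrier → Carrier → Carrier
  twisted-form φ κ σ x a = κ * (φ x * a + σ * (x * φ a))

  twisted-form-bilinear : ∀ {φ} → IsAdditive φ → ∀ κ σ → IsFpBilinear (twisted-form φ κ σ)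
  twisted-form-bilinear {φ} φ-add@(_ , φ-+) κ σ = add-x , add-a , scale-x , scale-a
    where
    add-x : ∀ x x′ a → twisted-form φ κ σ (x + x′) a ≈ twisted-form φ κ σ x a + twisted-form φ κ σ x′ a
    add-x x x′ a = trans (*-congˡ (+-congʳ (*-congʳ (φ-+ x x′)))) (split κ σ (φ x) (φ x′) x x′ a (φ a))
      where
      split : ∀ κ σ X X′ x x′ a A →
        κ * ((X + X′) * a + σ * ((x + x′) * A)) ≈ κ * (X * a + σ * (x * A)) + κ * (X′ * a + σ * (x′ * A))
      split = solve 8 (λ κ σ X X′ x x′ a A →
        κ :* ((X :+ X′) :* a :+ σ :* ((x :+ x′) :* A)) := κ :* (X :* a :+ σ :* (x :* A)) :+ κ :* (X′ :* a :+ σ :* (x′ :* A))) refl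
    add-a : ∀ x a a′ → twisted-form φ κ σ x (a + a′) ≈ twisted-form φ κ σ x a + twisted-form φ κ σ x a′
    add-a x a a′ = trans (*-congˡ (+-congˡ (*-congˡ (*-congˡ (φ-+ a a′))))) (split κ σ (φ x) x a a′ (φ a) (φ a′))
      where
      split : ∀ κ σ X x a a′ A A′ →
        κ * (X * (a + a′) + σ * (x * (A + A′))) ≈ κ * (X * a + σ * (x * A)) + κ * (X * a′ + σ * (x * A′))
      split = solve 8 (λ κ σ X x a a′ A A′ →
        κ :* (X :* (a :+ a′) :+ σ :* (x :* (A :+ A′))) := κ :* (X :* a :+ σ :* (x :* A)) :+ κ :* (X :* a′ :+ σ :* (x :* A′))) refl
    scale-x : ∀ k x a → twisted-form φ κ σ (k · x) a ≈ k · twisted-form φ κ σ x a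
    scale-x k x a = begin
      κ * (φ (k · x) * a + σ * ((k · x) * φ a))
        ≈⟨ *-congˡ (+-cong (*-congʳ (trans (additive-· φ-add k x) (·≈ι* k (φ x))))
                           (*-congˡ (*-congʳ (·≈ι* k x)))) ⟩
      κ * ((ι k * φ x) * a + σ * ((ι k * x) * φ a))
        ≈⟨ pull κ σ (ι k) (φ x) x a (φ a) ⟩
      ι k * twisted-form φ κ σ x a
        ≈⟨ ·≈ι* k _ ⟨
      k · twisted-form φ κ σ x a ∎
      where
      pull : ∀ κ σ I X x a A → κ * ((I * X) * a + σ * ((I * x) * A)) ≈ I * (κ * (X * a + σ * (x * A)))
      pull = solve 7 (λ κ σ I X x a A →
        κ :* ((I :* X) :* a :+ σ :* ((I :* x) :* A)) := I :* (κ :* (X :* a :+ σ :* (x :* A)))) refl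
    scale-a : ∀ k x a → twisted-form φ κ σ x (k · a) ≈ k · twisted-form φ κ σ x a
    scale-a k x a = begin
      κ * (φ x * (k · a) + σ * (x * φ (k · a)))
        ≈⟨ *-congˡ (+-cong (*-congˡ (·≈ι* k a))
                           (*-congˡ (*-congˡ (trans (additive-· φ-add k a) (·≈ι* k (φ a)))))) ⟩
      κ * (φ x * (ι k * a) + σ * (x * (ι k * φ a)))
        ≈⟨ pull κ σ (ι k) (φ x) x a (φ a) ⟩
      ι k * twisted-form φ κ σ x a
        ≈⟨ ·≈ι* k _ ⟨
      k · twisted-form φ κ σ x a ∎
      where
      pull : ∀ κ σ I X x a A → κ * (X * (I * a) + σ * (x * (I * A))) ≈ I * (κ * (X * a + σ * (x * A)))
      pull = solve 7 (λ κ σ I X x a A →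
        κ :* (X :* (I :* a) :+ σ :* (x :* (I :* A))) := I :* (κ :* (X :* a :+ σ :* (x :* A)))) refl

  -- The Frobenius map in characteristic p.

  open import Algebra.Properties.Semiring.Exp semiring using () renaming (_^_ to _^ᴿ_)
  open import Algebra.Properties.Semiring.Mult semiring using () renaming (_×_ to _×ᴿ_)
  open import Algebra.Properties.Monoid.Sum +-monoid using (sum)
  import Algebra.Properties.CommutativeSemiring.Binomial commutativeSemiring as Binomial

  ^ᴿ≈^ : ∀ n u → u ^ᴿ n ≈ u ^ n
  ^ᴿ≈^ zero    u = refl
  ^ᴿ≈^ (suc n) u = *-congˡ (^ᴿ≈^ n u)

  ×≈· : ∀ n u → n ×ᴿ u ≈ n · u
  ×≈· zero    u = refl
  ×≈· (suc n) u = +-congˡ (×≈· n u)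

  sum-last : ∀ m (g : Fin (suc m) → Carrier) → (∀ k → toℕ k < m → g k ≈ 0#) → sum g ≈ g (fromℕ m)
  sum-last zero    g below = +-identityʳ _
  sum-last (suc m) g below = trans
    (+-cong (below Fin.zero (s≤s z≤n))
            (sum-last m (λ k → g (Fin.suc k)) (λ k k<m → below (Fin.suc k) (s≤s k<m))))
    (+-identityˡ _)

  module Frobenius (m : ℕ) (prime : Prime (suc m)) (char : suc m · 1# ≈ 0#) where

    ι-char : ι (suc m) ≈ 0#
    ι-char = trans (sym (*-identityʳ _)) (trans (sym (·≈ι* (suc m) 1#)) char)

    multiple-vanishes : ∀ j w → suc m ∣ j → j ×ᴿ w ≈ 0#
    multiple-vanishes j w (divides q j≡q*p) rewrite j≡q*p = begin
      (q ℕ.* suc m) ×ᴿ w      ≈⟨ trans (×≈· (q ℕ.* suc m) w) (·≈ι* (q ℕ.* suc m) w) ⟩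
      ι (q ℕ.* suc m) * w     ≈⟨ *-congʳ (trans (ι-* q (suc m)) (*-congˡ ι-char)) ⟩
      (ι q * 0#) * w          ≈⟨ *-congʳ (zeroʳ (ι q)) ⟩
      0# * w                  ≈⟨ zeroˡ w ⟩
      0#                      ∎

    -- Binomial expansion: only the two outer terms survive modulo p.
    frobenius : ∀ u v → (u + v) ^ suc m ≈ u ^ suc m + v ^ suc m
    frobenius u v = begin
      (u + v) ^ suc m                              ≈⟨ ^ᴿ≈^ (suc m) (u + v) ⟨
      (u + v) ^ᴿ suc m                             ≈⟨ Binomial.theorem (suc m) u v ⟩
      term Fin.zero + sum (λ k → term (Fin.suc k))  ≈⟨ +-cong first (sum-last m _ middle) ⟩
      v ^ suc m + term (Fin.suc (fromℕ m))          ≈⟨ +-congˡ last ⟩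
      v ^ suc m + u ^ suc m                         ≈⟨ +-comm _ _ ⟩
      u ^ suc m + v ^ suc m                         ∎
      where
      term : Fin (suc (suc m)) → Carrier
      term = Binomial.binomialTerm u v (suc m)
      first : term Fin.zero ≈ v ^ suc m
      first = trans (+-identityʳ _) (trans (*-identityˡ _) (^ᴿ≈^ (suc m) v))
      middle : ∀ k → toℕ k < m → term (Fin.suc k) ≈ 0#
      middle k k<m = multiple-vanishes _ _ (prime∣binomial prime (s≤s z≤n) (s≤s k<m))
      last : term (Fin.suc (fromℕ m)) ≈ u ^ suc m
      last rewrite FinP.toℕ-fromℕ m | nCn≡1 (suc m) | ℕP.n∸n≡0 m =
        trans (+-identityʳ _) (trans (*-identityʳ _) (^ᴿ≈^ (suc m) u))

    -- t ↦ t^(p^i) is the i-fold iterate of the Frobenius map.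
    frobenius-power : ∀ i → IsAdditive (λ t → t ^ (suc m ℕ.^ i))
    frobenius-power i = ^-cong (suc m ℕ.^ i) , additivity i
      where
      additivity : ∀ i u v → (u + v) ^ (suc m ℕ.^ i) ≈ u ^ (suc m ℕ.^ i) + v ^ (suc m ℕ.^ i)
      additivity zero    u v = distribʳ 1# u v
      additivity (suc i) u v = begin
        (u + v) ^ (suc m ℕ.* suc m ℕ.^ i)             ≈⟨ ^-* (suc m) (suc m ℕ.^ i) (u + v) ⟩
        ((u + v) ^ suc m) ^ (suc m ℕ.^ i)             ≈⟨ ^-cong (suc m ℕ.^ i) (frobenius u v) ⟩
        (u ^ suc m + v ^ suc m) ^ (suc m ℕ.^ i)       ≈⟨ additivity i (u ^ suc m) (v ^ suc m) ⟩
        (u ^ suc m) ^ (suc m ℕ.^ i) + (v ^ suc m) ^ (suc m ℕ.^ i)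
          ≈⟨ +-cong (^-* (suc m) (suc m ℕ.^ i) u) (^-* (suc m) (suc m ℕ.^ i) v) ⟨
        u ^ (suc m ℕ.* suc m ℕ.^ i) + v ^ (suc m ℕ.* suc m ℕ.^ i) ∎

  -- Brackets as iterated finite differences.

  sumL-++ : (xs ys : List Carrier) → sumL (xs ++ ys) ≈ sumL xs + sumL ys
  sumL-++ []       ys = sym (+-identityˡ _)
  sumL-++ (x ∷ xs) ys = trans (+-congˡ (sumL-++ xs ys)) (sym (+-assoc _ _ _))

  module _ {A : Set} where
    sumL-map-cong : (L : List A) (u v : A → Carrier) → (∀ I → u I ≈ v I) →
      sumL (map u L) ≈ sumL (map v L)
    sumL-map-cong []      u v u≈v = refl
    sumL-map-cong (I ∷ L) u v u≈v = +-cong (u≈v I) (sumL-map-cong L u v u≈v)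

    sumL-map-+ : (L : List A) (u v : A → Carrier) →
      sumL (map (λ I → u I + v I) L) ≈ sumL (map u L) + sumL (map v L)
    sumL-map-+ []      u v = sym (+-identityˡ _)
    sumL-map-+ (I ∷ L) u v = trans (+-congˡ (sumL-map-+ L u v)) (regroup _ _ _ _)
      where
      regroup : ∀ a b c d → (a + b) + (c + d) ≈ (a + c) + (b + d)
      regroup = solve 4 (λ a b c d → (a :+ b) :+ (c :+ d) := (a :+ c) :+ (b :+ d)) refl

    sumL-map-* : (L : List A) (k : Carrier) (u : A → Carrier) →
      sumL (map (λ I → k * u I) L) ≈ k * sumL (map u L)
    sumL-map-* []      k u = sym (zeroʳ _)
    sumL-map-* (I ∷ L) k u = trans (+-congˡ (sumL-map-* L k u)) (sym (distribˡ _ _ _))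

  Δ : Carrier → (Carrier → Carrier) → Carrier → Carrier
  Δ c g t = g (c + t) - g t

  bracket-cong : ∀ m x g h → (∀ t → g t ≈ h t) → bracket g m x ≈ bracket h m x
  bracket-cong m x g h g≈h = sumL-map-cong (allSubsets m) _ _ (λ I → *-congˡ (g≈h _))

  bracket-+ : ∀ m x g h → bracket (λ t → g t + h t) m x ≈ bracket g m x + bracket h m x
  bracket-+ m x g h =
    trans (sumL-map-cong (allSubsets m) _ _ (λ I → distribˡ _ _ _)) (sumL-map-+ (allSubsets m) _ _)

  bracket-* : ∀ m x k g → bracket (λ t → k * g t) m x ≈ k * bracket g m x
  bracket-* m x k g =
    trans (sumL-map-cong (allSubsets m) _ _ (λ I → swap _ _ _)) (sumL-map-* (allSubsets m) k _)
    where
    swap : ∀ w k a → w * (k * a) ≈ k * (w * a)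
    swap = solve 3 (λ w k a → w :* (k :* a) := k :* (w :* a)) refl

  -- [g]^(m+1)(x_0, x_1, …) = [Δ_{x_0} g]^m(x_1, …): split the subsets of {0,…,m}
  -- according to whether they contain 0.
  bracket-step : ∀ m (x : Fin (suc m) → Carrier) g →
    bracket g (suc m) x ≈ bracket (Δ (x Fin.zero) g) m (λ k → x (Fin.suc k))
  bracket-step m x g = begin
    bracket g (suc m) x
      ≡⟨ ≡.cong sumL (ListP.map-++ _ (map (inside Vec.∷_) S) (map (outside Vec.∷_) S)) ⟩
    sumL (map term (map (inside Vec.∷_) S) ++ map term (map (outside Vec.∷_) S))
      ≈⟨ sumL-++ (map term (map (inside Vec.∷_) S)) (map term (map (outside Vec.∷_) S)) ⟩
    sumL (map term (map (inside Vec.∷_) S)) + sumL (map term (map (outside Vec.∷_) S))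
      ≡⟨ ≡.cong₂ (λ a b → sumL a + sumL b) (≡.sym (ListP.map-∘ S)) (≡.sym (ListP.map-∘ S)) ⟩
    sumL (map (λ I → term (inside Vec.∷ I)) S) + sumL (map (λ I → term (outside Vec.∷ I)) S)
      ≈⟨ +-congˡ (sumL-map-cong S _ _ without-0) ⟩
    sumL (map (λ I → w I * g (x Fin.zero + s I)) S) + sumL (map (λ I → - (w I * g (s I))) S)
      ≈⟨ sumL-map-+ S _ _ ⟨
    sumL (map (λ I → w I * g (x Fin.zero + s I) + - (w I * g (s I))) S)
      ≈⟨ sumL-map-cong S _ _ (λ I → factor (w I) _ _) ⟩
    bracket (Δ (x Fin.zero) g) m (λ k → x (Fin.suc k)) ∎
    where
    S : List (Subset m)
    S = allSubsets m
    term : Subset (suc m) → Carrier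
    term I = ((- 1#) ^ (suc m ∸ ∣ I ∣)) * g (sumOver I x)
    w : Subset m → Carrier
    w I = (- 1#) ^ (m ∸ ∣ I ∣)
    s : Subset m → Carrier
    s I = sumOver I (λ k → x (Fin.suc k))
    -- leaving out 0 flips the sign (-1)^(m+1-|I|)
    without-0 : ∀ I → term (outside Vec.∷ I) ≈ - (w I * g (s I))
    without-0 I rewrite ℕP.+-∸-assoc 1 (∣p∣≤n I) =
      trans (*-congʳ (-1*x≈-x _)) (sym (-‿distribˡ-* _ _))
    factor : ∀ w a b → w * a + - (w * b) ≈ w * (a - b)
    factor = solve 3 (λ w a b → w :* a :+ (:- (w :* b)) := w :* (a :- b)) refl

  -- Degrees and leading coefficients of polynomial functions.

  -- LowDeg d g: g is a polynomial function of degree < d.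
  -- Lead d a g: g(t) = a·t^d + r(t) with r of degree < d.
  LowDeg : ℕ → (Carrier → Carrier) → Set (c ⊔ ℓ)
  Lead   : ℕ → Carrier → (Carrier → Carrier) → Set (c ⊔ ℓ)
  LowDeg zero    g = ∀ t → g t ≈ 0#
  LowDeg (suc d) g = Σ Carrier λ a → Lead d a g
  Lead d a g = Σ (Carrier → Carrier) λ r → LowDeg d r × (∀ t → g t ≈ a * t ^ d + r t)

  low-cong : ∀ d {g h} → (∀ t → g t ≈ h t) → LowDeg d g → LowDeg d h
  lead-cong : ∀ d {a g h} → (∀ t → g t ≈ h t) → Lead d a g → Lead d a h
  low-cong zero    g≈h g-low t       = trans (sym (g≈h t)) (g-low t)
  low-cong (suc d) g≈h (a , g-lead)  = a , lead-cong d g≈h g-lead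
  lead-cong d g≈h (r , r-low , g≈) = r , r-low , λ t → trans (sym (g≈h t)) (g≈ t)

  lead-coef-cong : ∀ d {a b g} → a ≈ b → Lead d a g → Lead d b g
  lead-coef-cong d a≈b (r , r-low , g≈) = r , r-low , λ t → trans (g≈ t) (+-congʳ (*-congʳ a≈b))

  low-zero : ∀ d → LowDeg d (λ _ → 0#)
  low-zero zero    t = refl
  low-zero (suc d) = 0# , (λ _ → 0#) , low-zero d , λ t → sym (trans (+-identityʳ _) (zeroˡ _))

  low-+ : ∀ d {g h} → LowDeg d g → LowDeg d h → LowDeg d (λ t → g t + h t)
  lead-+ : ∀ d {a b g h} → Lead d a g → Lead d b h → Lead d (a + b) (λ t → g t + h t)
  low-+ zero    g-low h-low t = trans (+-cong (g-low t) (h-low t)) (+-identityˡ 0#)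
  low-+ (suc d) (a , g-lead) (b , h-lead) = a + b , lead-+ d g-lead h-lead
  lead-+ d (r , r-low , g≈) (s , s-low , h≈) = (λ t → r t + s t) , low-+ d r-low s-low ,
    λ t → trans (+-cong (g≈ t) (h≈ t)) (collect _ _ _ _ _)
    where
    collect : ∀ a b T R S → (a * T + R) + (b * T + S) ≈ (a + b) * T + (R + S)
    collect = solve 5 (λ a b T R S → (a :* T :+ R) :+ (b :* T :+ S) := (a :+ b) :* T :+ (R :+ S)) refl

  low-* : ∀ d k {g} → LowDeg d g → LowDeg d (λ t → k * g t)
  lead-* : ∀ d k {a g} → Lead d a g → Lead d (k * a) (λ t → k * g t)
  low-* zero    k g-low t       = trans (*-congˡ (g-low t)) (zeroʳ k)
  low-* (suc d) k (a , g-lead)  = k * a , lead-* d k g-lead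
  lead-* d k (r , r-low , g≈) = (λ t → k * r t) , low-* d k r-low ,
    λ t → trans (*-congˡ (g≈ t)) (distribute _ _ _ _)
    where
    distribute : ∀ k a T R → k * (a * T + R) ≈ (k * a) * T + k * R
    distribute = solve 4 (λ k a T R → k :* (a :* T :+ R) := (k :* a) :* T :+ k :* R) refl

  low-raise : ∀ d {g} → LowDeg d g → LowDeg (suc d) g
  low-raise d {g} g-low = 0# , g , g-low , λ t → sym (trans (+-congʳ (zeroˡ _)) (+-identityˡ _))

  lead-+low : ∀ d {a g h} → Lead d a g → LowDeg d h → Lead d a (λ t → g t + h t)
  lead-+low d g-lead h-low =
    lead-coef-cong d (+-identityʳ _) (lead-+ d g-lead (_ , h-low , λ t → sym (trans (+-congʳ (zeroˡ _)) (+-identityˡ _))))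

  lead-*t : ∀ d {a g} → Lead d a g → Lead (suc d) a (λ t → t * g t)
  low-*t : ∀ d {g} → LowDeg d g → LowDeg (suc d) (λ t → t * g t)
  lead-*t d (r , r-low , g≈) = (λ t → t * r t) , low-*t d r-low ,
    λ t → trans (*-congˡ (g≈ t)) (distribute _ _ _ _)
    where
    distribute : ∀ t a T R → t * (a * T + R) ≈ a * (t * T) + t * R
    distribute = solve 4 (λ t a T R → t :* (a :* T :+ R) := a :* (t :* T) :+ t :* R) refl
  low-*t zero    g-low        = low-raise zero (λ t → trans (*-congˡ (g-low t)) (zeroʳ t))
  low-*t (suc d) (a , g-lead) = a , lead-*t d g-lead

  monomial : ∀ d → Lead d 1# (λ t → t ^ d)
  monomial d = (λ _ → 0#) , low-zero d , λ t → sym (trans (+-identityʳ _) (*-identityˡ _))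

  -- Δ_y t^(d+1) = (d+1)·y·t^d + lower terms, by induction via
  -- (y+t)·P - t·Q = t·(P - Q) + y·Q + y·(P - Q).
  Δ-monomial : ∀ y d → Lead d (ι (suc d) * y) (Δ y (λ t → t ^ suc d))
  Δ-monomial y zero = (λ _ → 0#) , low-zero zero , expand y
    where
    expand : ∀ y t → (y + t) * 1# - t * 1# ≈ (1# * y) * 1# + 0#
    expand = solve 2 (λ y t → (y :+ t) :* :1 :- t :* :1 := (:1 :* y) :* :1 :+ :0) refl
  Δ-monomial y (suc d) =
    lead-coef-cong (suc d) (coefficient (ι (suc d)) y)
      (lead-cong (suc d) (λ t → sym (expand y t ((y + t) ^ suc d) (t ^ suc d)))
        (lead-+low (suc d)
          (lead-+ (suc d) (lead-*t d (Δ-monomial y d)) (lead-* (suc d) y (monomial (suc d))))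
          (low-* (suc d) y (_ , Δ-monomial y d))))
    where
    expand : ∀ y t P Q → (y + t) * P - t * Q ≈ (t * (P - Q) + y * Q) + y * (P - Q)
    expand = solve 4 (λ y t P Q → (y :+ t) :* P :- t :* Q := (t :* (P :- Q) :+ y :* Q) :+ y :* (P :- Q)) refl
    coefficient : ∀ I y → I * y + y * 1# ≈ (1# + I) * y
    coefficient = solve 2 (λ I y → I :* y :+ y :* :1 := (:1 :+ I) :* y) refl

  split-difference : ∀ a P Q R₁ R₀ → (a * P + R₁) - (a * Q + R₀) ≈ a * (P - Q) + (R₁ - R₀)
  split-difference = solve 5 (λ a P Q R₁ R₀ → (a :* P :+ R₁) :- (a :* Q :+ R₀) := a :* (P :- Q) :+ (R₁ :- R₀)) refl

  Δ-low : ∀ y d {g} → LowDeg (suc d) g → LowDeg d (Δ y g)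
  Δ-low y zero (a , r , r-low , g≈) t =
    trans (+-cong (trans (g≈ _) (+-congˡ (r-low _))) (-‿cong (trans (g≈ t) (+-congˡ (r-low t)))))
          (cancel (a * 1#))
    where
    cancel : ∀ A → (A + 0#) - (A + 0#) ≈ 0#
    cancel = solve 1 (λ A → (A :+ :0) :- (A :+ :0) := :0) refl
  Δ-low y (suc d) (a , r , r-low , g≈) =
    low-cong (suc d) (λ t → sym (trans (+-cong (g≈ _) (-‿cong (g≈ t))) (split-difference a _ _ _ _)))
      (low-+ (suc d) (low-* (suc d) a (_ , Δ-monomial y d)) (low-raise d (Δ-low y d r-low)))

  Δ-lead : ∀ y d {a g} → Lead (suc d) a g → Lead d (a * (ι (suc d) * y)) (Δ y g)
  Δ-lead y d {a} (r , r-low , g≈) =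
    lead-cong d (λ t → sym (trans (+-cong (g≈ _) (-‿cong (g≈ t))) (split-difference a _ _ _ _)))
      (lead-+low d (lead-* d a (Δ-monomial y d)) (Δ-low y d r-low))

  -- Translating the argument, t ↦ h(y+t) = h(t) + Δ_y h(t), keeps the leading term.
  lead-shift : ∀ y d {a h} → Lead (suc d) a h → Lead (suc d) a (λ t → h (y + t))
  lead-shift y d {h = h} h-lead = lead-cong (suc d) (λ t → telescope (h t) (h (y + t)))
    (lead-+low (suc d) h-lead (_ , Δ-lead y d h-lead))
    where
    telescope : ∀ H₀ H₁ → H₀ + (H₁ - H₀) ≈ H₁
    telescope = solve 2 (λ H₀ H₁ → H₀ :+ (H₁ :- H₀) := H₁) refl

  bracket-lead : ∀ y m {a g} → Lead m a g → bracket g m (λ _ → y) ≈ (ι (m !) * a) * y ^ m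
  bracket-lead y zero {a} (r , r-low , g≈) =
    trans (+-congʳ (*-congˡ (trans (g≈ 0#) (+-congˡ (r-low 0#))))) (simplify a)
    where
    simplify : ∀ a → (1# * (a * 1# + 0#)) + 0# ≈ (1# * a) * 1#
    simplify = solve 1 (λ a → (:1 :* (a :* :1 :+ :0)) :+ :0 := (:1 :* a) :* :1) refl
  bracket-lead y (suc m) {a} {g} g-lead = begin
    bracket g (suc m) (λ _ → y)                 ≈⟨ bracket-step m (λ _ → y) g ⟩
    bracket (Δ y g) m (λ _ → y)                 ≈⟨ bracket-lead y m (Δ-lead y m g-lead) ⟩
    (ι (m !) * (a * (ι (suc m) * y))) * y ^ m   ≈⟨ regroup _ _ _ _ _ ⟩
    ((ι (suc m) * ι (m !)) * a) * (y * y ^ m)   ≈⟨ *-congʳ (*-congʳ (ι-* (suc m) (m !))) ⟨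
    (ι (suc m !) * a) * y ^ suc m               ∎
    where
    regroup : ∀ F a S y Y → (F * (a * (S * y))) * Y ≈ ((S * F) * a) * (y * Y)
    regroup = solve 5 (λ F a S y Y → (F :* (a :* (S :* y))) :* Y := ((S :* F) :* a) :* (y :* Y)) refl

  -- Leibniz rule for an additive factor A: if h has degree m and leading
  -- coefficient a then [A·h]^(m+1)(y,…,y) = (m+1)!·A(y)·a·y^m.  The step uses
  -- Δ_y(A·h)(t) = A(t)·Δ_y h(t) + A(y)·h(y+t).
  bracket-leibniz : ∀ y {A} → IsAdditive A → ∀ m {a h} → Lead m a h →
    bracket (λ t → A t * h t) (suc m) (λ _ → y) ≈ ((ι (suc m !) * A y) * a) * y ^ m
  bracket-leibniz y {A} A-add@(A-cong , A-+) zero {a} {h} (r , r-low , h≈) = begin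
    bracket (λ t → A t * h t) 1 (λ _ → y)
      ≈⟨ bracket-step 0 (λ _ → y) (λ t → A t * h t) ⟩
    (1# * (A (y + 0#) * h (y + 0#) - A 0# * h 0#)) + 0#
      ≈⟨ +-congʳ (*-congˡ (+-cong (*-cong (A-cong (+-identityʳ y)) (constant _))
                                  (-‿cong (*-cong (additive-0 A-add) (constant 0#))))) ⟩
    (1# * (A y * a - 0# * a)) + 0#
      ≈⟨ simplify (A y) a ⟩
    ((1# * A y) * a) * 1# ∎
    where
    constant : ∀ u → h u ≈ a
    constant u = trans (h≈ u) (trans (+-cong (*-identityʳ a) (r-low u)) (+-identityʳ a))
    simplify : ∀ Ay a → (1# * (Ay * a - 0# * a)) + 0# ≈ ((1# * Ay) * a) * 1#
    simplify = solve 2 (λ Ay a → (:1 :* (Ay :* a :- :0 :* a)) :+ :0 := ((:1 :* Ay) :* a) :* :1) refl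
  bracket-leibniz y {A} A-add@(A-cong , A-+) (suc m) {a} {h} h-lead = begin
    bracket (λ t → A t * h t) (suc (suc m)) (λ _ → y)
      ≈⟨ bracket-step (suc m) (λ _ → y) (λ t → A t * h t) ⟩
    bracket (Δ y (λ t → A t * h t)) (suc m) (λ _ → y)
      ≈⟨ bracket-cong (suc m) (λ _ → y) _ _ product-rule ⟩
    bracket (λ t → A t * Δ y h t + A y * h (y + t)) (suc m) (λ _ → y)
      ≈⟨ bracket-+ (suc m) (λ _ → y) (λ t → A t * Δ y h t) (λ t → A y * h (y + t)) ⟩
    bracket (λ t → A t * Δ y h t) (suc m) (λ _ → y) + bracket (λ t → A y * h (y + t)) (suc m) (λ _ → y)
      ≈⟨ +-congˡ (bracket-* (suc m) (λ _ → y) (A y) (λ t → h (y + t))) ⟩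
    bracket (λ t → A t * Δ y h t) (suc m) (λ _ → y) + A y * bracket (λ t → h (y + t)) (suc m) (λ _ → y)
      ≈⟨ +-cong (bracket-leibniz y A-add m (Δ-lead y m h-lead))
                (*-congˡ (bracket-lead y (suc m) (lead-shift y m h-lead))) ⟩
    ((ι (suc m !) * A y) * (a * (ι (suc m) * y))) * y ^ m + A y * ((ι (suc m !) * a) * (y * y ^ m))
      ≈⟨ collect (ι (suc m !)) (ι (suc m)) (A y) a y (y ^ m) ⟩
    ((((1# + ι (suc m)) * ι (suc m !)) * A y) * a) * (y * y ^ m)
      ≈⟨ *-congʳ (*-congʳ (*-congʳ (trans (ι-* (suc (suc m)) (suc m !)) (*-congʳ (ι-suc (suc m)))))) ⟨
    ((ι (suc (suc m) !) * A y) * a) * y ^ suc m ∎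
    where
    product-rule : ∀ t → Δ y (λ t → A t * h t) t ≈ A t * Δ y h t + A y * h (y + t)
    product-rule t = trans (+-congʳ (*-congʳ (A-+ y t))) (expand (A y) (A t) (h (y + t)) (h t))
      where
      expand : ∀ Ay At H₁ H₀ → (Ay + At) * H₁ - At * H₀ ≈ At * (H₁ - H₀) + Ay * H₁
      expand = solve 4 (λ Ay At H₁ H₀ → (Ay :+ At) :* H₁ :- At :* H₀ := At :* (H₁ :- H₀) :+ Ay :* H₁) refl
    collect : ∀ F S Ay a y Y → ((F * Ay) * (a * (S * y))) * Y + Ay * ((F * a) * (y * Y))
                             ≈ ((((1# + S) * F) * Ay) * a) * (y * Y)
    collect = solve 6 (λ F S Ay a y Y → ((F :* Ay) :* (a :* (S :* y))) :* Y :+ Ay :* ((F :* a) :* (y :* Y))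
                             := ((((:1 :+ S) :* F) :* Ay) :* a) :* (y :* Y)) refl

  module Computation (d : ℕ) (prime : Prime (suc (suc d))) (char : suc (suc d) · 1# ≈ 0#) (i : ℕ) where
    open Frobenius (suc d) prime char using (frobenius-power)

    p q : ℕ
    p = suc (suc d)
    q = p ℕ.^ i

    f : Carrier → Carrier
    f x = x ^ (p ℕ.^ i ℕ.+ p ∸ 1)

    K S : Carrier
    K = ι (suc d !)
    S = ι (suc d)

    frob : IsAdditive (λ t → t ^ q)
    frob = frobenius-power i

    -- Δ_x f(t) = x^q (x+t)^(p-1) + t^q Δ_x(t^(p-1)), by f(u) = u^q u^(p-1) and Frobenius.
    Δf : ∀ x t → Δ x f t ≈ x ^ q * (x + t) ^ suc d + t ^ q * Δ x (λ t → t ^ suc d) t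
    Δf x t = trans (+-cong (trans (f-split (x + t)) (*-congʳ (proj₂ frob x t))) (-‿cong (f-split t)))
                   (regroup (x ^ q) (t ^ q) ((x + t) ^ suc d) (t ^ suc d))
      where
      f-split : ∀ u → f u ≈ u ^ q * u ^ suc d
      f-split u = trans (reflexive (≡.cong (u ^_) (ℕP.+-∸-assoc q {p} {1} (s≤s z≤n)))) (^-+ q (suc d) u)
      regroup : ∀ X T P Q → (X + T) * P - T * Q ≈ X * P + T * (P - Q)
      regroup = solve 4 (λ X T P Q → (X :+ T) :* P :- T :* Q := X :* P :+ T :* (P :- Q)) refl

    Btilde-value : ∀ x y → Btilde p f x y ≈ x ^ q * ((K * 1#) * y ^ suc d) + ((K * y ^ q) * (S * x)) * y ^ d
    Btilde-value x y = begin
      Btilde p f x y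
        ≈⟨ bracket-step (suc d) _ f ⟩
      bracket (Δ x f) (suc d) (λ _ → y)
        ≈⟨ bracket-cong (suc d) (λ _ → y) _ _ (Δf x) ⟩
      bracket (λ t → x ^ q * (x + t) ^ suc d + t ^ q * Δ x (λ t → t ^ suc d) t) (suc d) (λ _ → y)
        ≈⟨ bracket-+ (suc d) (λ _ → y) (λ t → x ^ q * (x + t) ^ suc d) (λ t → t ^ q * Δ x (λ t → t ^ suc d) t) ⟩
      bracket (λ t → x ^ q * (x + t) ^ suc d) (suc d) (λ _ → y)
        + bracket (λ t → t ^ q * Δ x (λ t → t ^ suc d) t) (suc d) (λ _ → y)
        ≈⟨ +-congʳ (bracket-* (suc d) (λ _ → y) (x ^ q) (λ t → (x + t) ^ suc d)) ⟩
      x ^ q * bracket (λ t → (x + t) ^ suc d) (suc d) (λ _ → y)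
        + bracket (λ t → t ^ q * Δ x (λ t → t ^ suc d) t) (suc d) (λ _ → y)
        ≈⟨ +-cong (*-congˡ (bracket-lead y (suc d) (lead-shift x d (monomial (suc d)))))
                  (bracket-leibniz y frob d (Δ-monomial x d)) ⟩
      x ^ q * ((K * 1#) * y ^ suc d) + ((K * y ^ q) * (S * x)) * y ^ d ∎

    B : Carrier → Carrier → Carrier
    B = BtildeMuNu p f (λ a _ y → ((a ⁻¹) ^ (p ∸ 2)) * y) (λ a → a)

    B-value : ∀ x a → B x a ≈ twisted-form (λ t → t ^ q) K S x a
    B-value x a with Field._≟_ F a 0#
    ... | yes a≈0 = sym (trans
          (*-congˡ (+-cong (*-congˡ a≈0) (*-congˡ (*-congˡ (trans (proj₁ frob a≈0) (additive-0 frob))))))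
          (vanish K (x ^ q) S x))
      where
      vanish : ∀ K X S x → K * (X * 0# + S * (x * 0#)) ≈ 0#
      vanish = solve 4 (λ K X S x → K :* (X :* :0 :+ S :* (x :* :0)) := :0) refl
    ... | no a≉0 = begin
      (a ⁻¹) ^ d * Btilde p f x a
        ≈⟨ *-congˡ (Btilde-value x a) ⟩
      (a ⁻¹) ^ d * (x ^ q * ((K * 1#) * (a * a ^ d)) + ((K * a ^ q) * (S * x)) * a ^ d)
        ≈⟨ regroup ((a ⁻¹) ^ d) (a ^ d) (x ^ q) K a (a ^ q) S x ⟩
      ((a ⁻¹) ^ d * a ^ d) * twisted-form (λ t → t ^ q) K S x a
        ≈⟨ *-congʳ inverse-power ⟩
      1# * twisted-form (λ t → t ^ q) K S x a
        ≈⟨ *-identityˡ _ ⟩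
      twisted-form (λ t → t ^ q) K S x a ∎
      where
      regroup : ∀ Z Y X K a Aq S x → Z * (X * ((K * 1#) * (a * Y)) + ((K * Aq) * (S * x)) * Y)
                                     ≈ (Z * Y) * (K * (X * a + S * (x * Aq)))
      regroup = solve 8 (λ Z Y X K a Aq S x → Z :* (X :* ((K :* :1) :* (a :* Y)) :+ ((K :* Aq) :* (S :* x)) :* Y)
                                     := (Z :* Y) :* (K :* (X :* a :+ S :* (x :* Aq)))) refl
      inverse-power : (a ⁻¹) ^ d * a ^ d ≈ 1#
      inverse-power = trans (sym (^-distrib-* d (a ⁻¹) a))
                            (trans (^-cong d (trans (*-comm _ _) (Field.inverse F a a≉0))) (1^n d))

    bilinear : IsFpBilinear B
    bilinear = bilinear-resp B-value (twisted-form-bilinear frob K S)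

proposition5p3 : ∀ {c ℓ : Level} (p n i : ℕ) → Prime p → n ≥ 1 → i ≥ 1 → gcd i n ≡ 1 →
    (F : Field c ℓ) → let open FieldOps F in
    HasCard (p Data.Nat.^ n) → (p · 1#) ≈ 0# →
    IsFpBilinear (BtildeMuNu p (λ x → x ^ (p Data.Nat.^ i Data.Nat.+ p ∸ 1))
    (λ a _ y → ((a ⁻¹) ^ (p ∸ 2)) * y) (λ a → a))
proposition5p3 zero          _ _ pr = contradiction (ℕ.nonTrivial⇒n>1 0 {{prime⇒nonTrivial pr}}) λ ()
proposition5p3 (suc zero)    _ _ pr = contradiction (ℕ.nonTrivial⇒n>1 1 {{prime⇒nonTrivial pr}}) λ { (s≤s ()) }
proposition5p3 (suc (suc d)) _ i pr _ _ _ F _ char = FieldFacts.Computation.bilinear F d pr char i
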